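{- Let $a>1$, $m$, $s$, $k$ be positive integers, let $r=2ams-1$, and set \[ D:=m\left(m\left(s+ar^k\right)^2-2r^k\right). \] Define $b_1,\dots,b_{3k}$ by $b_{3j+1}=1$, $b_{3j+2}=ar^j-1$, $b_{3j+3}=2amr^{k-1-j}-1$ for $0\le j\le k-1$ (so the sequence is $1,a-1,2amr^{k-1}-1,\ 1,ar-1,2amr^{k-2}-1,\dots,1,ar^{k-1}-1,2am-1$). Then $l(D)=6k+4$ and \[ \sqrt D=[m(s+ar^k)-1;\overline{b_1,\dots,b_{3k},\,1,\,s+ar^k-2,\,1,\,b_{3k},\dots,b_1,\,2m(s+ar^k)-2}]. \]
   Context: For a positive non-square integer $D$, $l(D)$ denotes the length of the fundamental (shortest) period of the regular continued fraction expansion of $\sqrt D$. $[a_0;\overline{b_1,\dots,b_m}]$ denotes the regular continued fraction whose partial quotients after $a_0$ are the block $b_1,\dots,b_m$ repeated infinitely often. -}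

module Defs where

open import Data.Nat using (ℕ; zero; suc; _+_; _*_; _∸_; _^_; _≤_; _<_; _≤ᵇ_)
open import Data.Nat.DivMod using (_/_)
open import Data.Bool using (if_then_else_)
open import Data.List using (List; []; _∷_; _++_; concatMap; upTo; reverse)
open import Data.Product using (_×_; _,_; proj₁; proj₂)
open import Relation.Binary.PropositionalEquality using (_≡_)
open import Relation.Nullary using (¬_)

isqrt : ℕ → ℕ
isqrt zero = zero
isqrt (suc n) with isqrt n
... | r = if (suc r * suc r) ≤ᵇ suc n then suc r else r

-- natural division, total (x / 0 := 0; never used for non-square D)
divℕ : ℕ → ℕ → ℕ
divℕ x zero = zero
divℕ x (suc q) = x / suc q

-- Complete quotients of √D written as x_n = (P_n + √D) / Q_n.
-- P_0 = 0, Q_0 = 1, a_n = ⌊x_n⌋ = ⌊(P_n + ⌊√D⌋)/Q_n⌋,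
-- P_{n+1} = a_n Q_n - P_n, Q_{n+1} = (D - P_{n+1}^2)/Q_n, x_{n+1} = 1/(x_n - a_n).
PQ : ℕ → ℕ → ℕ × ℕ
PQ D zero = 0 , 1
PQ D (suc n) with PQ D n
... | P , Q =
  let a  = divℕ (P + isqrt D) Q
      P' = a * Q ∸ P
  in P' , divℕ (D ∸ P' * P') Q

cfSqrt : ℕ → ℕ → ℕ
cfSqrt D n = divℕ (proj₁ (PQ D n) + isqrt D) (proj₂ (PQ D n))

IsPeriod : ℕ → ℕ → Set
IsPeriod D L = (0 < L) × (∀ n → 1 ≤ n → cfSqrt D (n + L) ≡ cfSqrt D n)

PeriodLength : ℕ → ℕ → Set
PeriodLength D L = IsPeriod D L × (∀ L' → 0 < L' → L' < L → ¬ IsPeriod D L')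

nth : List ℕ → ℕ → ℕ
nth [] _ = 0
nth (x ∷ xs) zero = x
nth (x ∷ xs) (suc i) = nth xs i

bSeq : ℕ → ℕ → ℕ → ℕ → List ℕ
bSeq a m r k =
  concatMap (λ j → 1 ∷ (a * r ^ j ∸ 1) ∷ (2 * a * m * r ^ (k ∸ 1 ∸ j) ∸ 1) ∷ []) (upTo k)

periodBlock : ℕ → ℕ → ℕ → ℕ → List ℕ
periodBlock a m s k =
  let r = 2 * a * m * s ∸ 1
      t = s + a * r ^ k
  in bSeq a m r k ++ (1 ∷ (t ∸ 2) ∷ 1 ∷ []) ++ reverse (bSeq a m r k) ++ ((2 * m * t ∸ 2) ∷ [])

module Submission where

-- Put t = s + a r^k, M = m t and R = r^k, so that D = M² − 2mR and ⌊√D⌋ = M − 1. Every complete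
-- quotient (P + √D)/Q met along the expansion has P = M − d for a "deficit" d, and in terms of
-- deficits a step of the recurrence (a Q = P + P′, Q Q′ = D − P′²) becomes a pair of
-- subtraction-free identities. For each factorisation R = x z with x = r^j, z = r^(k−j) the
-- deficits and denominators that occur are x, 2mz, 2ms and 2M − x − 2mz; the steps through the
-- deficit 2ms close up because r + 1 = 2ams. The first half of the period raises j from 0 to k,
-- the second half lowers it again, and after the last partial quotient 2M − 2 the expansion is
-- back at the complete quotient following a₀. Every other partial quotient of the period is at
-- most M − 1, which rules out a shorter period.

open import Defs
open import Function using (id; _∘_)
open import Data.Bool using (true; false; T)
open import Data.Unit using (tt)
open import Data.Empty using (⊥-elim)
open import Data.Nat
  using (ℕ; zero; suc; _+_; _*_; _∸_; _^_; _≤_; _<_; _%_; _/_; _≤ᵇ_; z≤n; s≤s; NonZero; >-nonZero)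
open import Data.Nat.Properties
open import Data.Nat.DivMod using (m*n/n≡m; /-monoˡ-≤; m<n*o⇒m/o<n; m≡m%n+[m/n]*n; m%n<n)
open import Data.Nat.Tactic.RingSolver using (solve-∀)
open import Data.List
  using (List; []; _∷_; _++_; concat; concatMap; map; reverse; applyUpTo; applyDownFrom; upTo; length)
open import Data.List.Properties
  using ( reverse-++; concat-++; ++-identityʳ; unfold-reverse; map-upTo; map-applyUpTo; reverse-applyUpTo
        ; ++-assoc; length-++; length-reverse)
open import Data.List.Relation.Unary.All using (All; []; _∷_; tabulate; lookup)
open import Data.List.Relation.Unary.All.Properties using (++⁺; concat⁺; map⁺; applyUpTo⁺₁)
open import Data.List.Relation.Unary.Any.Properties using (reverse⁻)
open import Data.Product using (_×_; _,_; proj₁; proj₂)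
open import Relation.Nullary using (¬_)
open import Relation.Binary.PropositionalEquality

-- Integer square roots

isqrt-spec : ∀ n → isqrt n * isqrt n ≤ n × n < suc (isqrt n) * suc (isqrt n)
isqrt-spec zero = z≤n , s≤s z≤n
isqrt-spec (suc n) with isqrt n | isqrt-spec n
... | r | r²≤n , n<[1+r]² with suc r * suc r ≤ᵇ suc n in test
... | true  = ≤ᵇ⇒≤ _ _ (subst T (sym test) tt)
            , ≤-<-trans n<[1+r]² (*-mono-< (n<1+n (suc r)) (n<1+n (suc r)))
... | false = m≤n⇒m≤1+n r²≤n , ≰⇒> (λ le → subst T test (≤⇒≤ᵇ le))

root-≤ : ∀ {n x y} → x * x ≤ n → n < suc y * suc y → x ≤ y
root-≤ x²≤n n<[1+y]² =
  ≮⇒≥ (λ y<x → <-irrefl refl (<-≤-trans n<[1+y]² (≤-trans (*-mono-≤ y<x y<x) x²≤n)))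

isqrt-unique : ∀ {n w} → w * w ≤ n → n < suc w * suc w → isqrt n ≡ w
isqrt-unique {n} w²≤n n<[1+w]² =
  ≤-antisym (root-≤ (proj₁ (isqrt-spec n)) n<[1+w]²) (root-≤ w²≤n (proj₂ (isqrt-spec n)))

nonsquare : ∀ {D w} → w * w < D → D < suc w * suc w → ∀ x → x * x ≢ D
nonsquare {D} {w} w²<D D<[1+w]² x x²≡D = <-irrefl x²≡D (≤-<-trans (*-mono-≤ x≤w x≤w) w²<D)
  where
  x≤w : x ≤ w
  x≤w = root-≤ (≤-reflexive x²≡D) D<[1+w]²

between-squares : ∀ {D E w} → D + E ≡ suc w * suc w → 1 ≤ E → E ≤ w + w →
                  w * w < D × D < suc w * suc w
between-squares {D} {E} {w} D+E≡[1+w]² 1≤E E≤2w =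
  +-cancelʳ-< E (w * w) D w²+E<D+E , subst (D <_) D+E≡[1+w]² (m<m+n D 1≤E)
  where
  square-suc : ∀ w → suc w * suc w ≡ suc (w * w + (w + w))
  square-suc = solve-∀
  w²+E<D+E : w * w + E < D + E
  w²+E<D+E = begin-strict
    w * w + E              ≤⟨ +-monoʳ-≤ (w * w) E≤2w ⟩
    w * w + (w + w)        <⟨ n<1+n _ ⟩
    suc (w * w + (w + w))  ≡⟨ sym (square-suc w) ⟩
    suc w * suc w          ≡⟨ sym D+E≡[1+w]² ⟩
    D + E                  ∎
    where open ≤-Reasoning

-- One step of the expansion of √D

divℕ-unique : ∀ {x q A} → A * suc q ≤ x → x < A * suc q + suc q → divℕ x (suc q) ≡ A
divℕ-unique {x} {q} {A} lower upper = ≤-antisym (<⇒≤pred (m<n*o⇒m/o<n upper′)) A≤x/q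
  where
  upper′ : x < suc A * suc q
  upper′ = subst (x <_) (+-comm (A * suc q) (suc q)) upper
  A≤x/q : A ≤ x / suc q
  A≤x/q = subst (_≤ x / suc q) (m*n/n≡m A (suc q)) (/-monoˡ-≤ (suc q) lower)

divℕ-exact : ∀ q Q′ → divℕ (suc q * Q′) (suc q) ≡ Q′
divℕ-exact q Q′ = trans (cong (_/ suc q) (*-comm (suc q) Q′)) (m*n/n≡m Q′ (suc q))

-- Since A Q = P + P′, the floor condition that defines A reduces to P′ ≤ w < P′ + Q.
PQ-step : ∀ {D n w P Q A P′ Q′} → isqrt D ≡ w → PQ D n ≡ (P , Q) →
          A * Q ≡ P + P′ → D ≡ P′ * P′ + Q * Q′ → P′ ≤ w → w < P′ + Q →
          PQ D (suc n) ≡ (P′ , Q′) × cfSqrt D n ≡ A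
PQ-step {Q = zero} {P′ = P′} _ _ _ _ P′≤w w<P′+0 =
  ⊥-elim (<⇒≱ w<P′+0 (≤-trans (≤-reflexive (+-identityʳ P′)) P′≤w))
PQ-step {D} {n} {_} {P} {suc q} {A} {P′} {Q′} refl PQₙ sum norm P′≤w w<P′+Q rewrite PQₙ =
  cong₂ _,_ P″≡P′ (trans (cong (λ p → divℕ (D ∸ p * p) (suc q)) P″≡P′) Q″≡Q′) , quotient
  where
  lower : A * suc q ≤ P + isqrt D
  lower = subst (_≤ P + isqrt D) (sym sum) (+-monoʳ-≤ P P′≤w)
  upper : P + isqrt D < A * suc q + suc q
  upper = subst (P + isqrt D <_) (trans (sym (+-assoc P P′ (suc q))) (cong (_+ suc q) (sym sum)))
                (+-monoʳ-< P w<P′+Q)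
  quotient : divℕ (P + isqrt D) (suc q) ≡ A
  quotient = divℕ-unique lower upper
  P″≡P′ : divℕ (P + isqrt D) (suc q) * suc q ∸ P ≡ P′
  P″≡P′ = trans (cong (λ a → a * suc q ∸ P) quotient) (trans (cong (_∸ P) sum) (m+n∸m≡n P P′))
  Q″≡Q′ : divℕ (D ∸ P′ * P′) (suc q) ≡ Q′
  Q″≡Q′ = trans (cong (λ d → divℕ (d ∸ P′ * P′) (suc q)) norm)
                (trans (cong (λ d → divℕ d (suc q)) (m+n∸m≡n (P′ * P′) _)) (divℕ-exact q Q′))

-- state d Q is the complete quotient (M − d + √D)/Q, and Norm d Q Q′ is D = (M − d)² + Q Q′ with
-- D = M² − E expanded so that no subtraction occurs.
module Deficits {D M E : ℕ} (D+E≡M*M : D + E ≡ M * M) (isqrt≡M∸1 : isqrt D ≡ M ∸ 1) where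

  state : ℕ → ℕ → ℕ × ℕ
  state d Q = M ∸ d , Q

  Norm : ℕ → ℕ → ℕ → Set
  Norm d Q Q′ = Q * Q′ + d * d + E ≡ (M + M) * d

  Norm-comm : ∀ {d} Q Q′ → Norm d Q Q′ → Norm d Q′ Q
  Norm-comm {d} Q Q′ = subst (λ x → x + d * d + E ≡ (M + M) * d) (*-comm Q Q′)

  Norm-split : ∀ c c̄ Q → c * c̄ ≡ E → Q + (c + c̄) ≡ M + M → Norm c c Q
  Norm-split c c̄ Q cc̄≡E Q+c+c̄≡M+M = begin
    c * Q + c * c + E         ≡⟨ cong (c * Q + c * c +_) (sym cc̄≡E) ⟩
    c * Q + c * c + c * c̄    ≡⟨ distrib c Q c̄ ⟩
    c * (Q + (c + c̄))        ≡⟨ cong (c *_) Q+c+c̄≡M+M ⟩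
    c * (M + M)              ≡⟨ *-comm c (M + M) ⟩
    (M + M) * c              ∎
    where
    open ≡-Reasoning
    distrib : ∀ c Q c̄ → c * Q + c * c + c * c̄ ≡ c * (Q + (c + c̄))
    distrib = solve-∀

  private
    sum-of-deficits : ∀ {x d d′} → d ≤ M → d′ ≤ M → x + (d + d′) ≡ M + M →
                      x ≡ (M ∸ d) + (M ∸ d′)
    sum-of-deficits {x} {d} {d′} d≤M d′≤M sum = +-cancelʳ-≡ (d + d′) x _ (begin
      x + (d + d′)                    ≡⟨ sum ⟩
      M + M                           ≡⟨ cong₂ _+_ (sym (m∸n+n≡m d≤M)) (sym (m∸n+n≡m d′≤M)) ⟩
      (M ∸ d + d) + (M ∸ d′ + d′)     ≡⟨ regroup (M ∸ d) d (M ∸ d′) d′ ⟩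
      (M ∸ d) + (M ∸ d′) + (d + d′)   ∎)
      where
      open ≡-Reasoning
      regroup : ∀ u d v d′ → (u + d) + (v + d′) ≡ u + v + (d + d′)
      regroup = solve-∀

    completing-square : ∀ {p d y} → D + E ≡ (p + d) * (p + d) →
                        y + d * d + E ≡ ((p + d) + (p + d)) * d → D ≡ p * p + y
    completing-square {p} {d} {y} D+E≡[p+d]² norm =
      +-cancelʳ-≡ E D (p * p + y) (+-cancelʳ-≡ (d * d) _ _ (begin
        D + E + d * d                     ≡⟨ cong (_+ d * d) D+E≡[p+d]² ⟩
        (p + d) * (p + d) + d * d         ≡⟨ expand p d ⟩
        p * p + ((p + d) + (p + d)) * d   ≡⟨ cong (p * p +_) (sym norm) ⟩
        p * p + (y + d * d + E)           ≡⟨ regroup p y d E ⟩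
        p * p + y + E + d * d             ∎))
      where
      open ≡-Reasoning
      expand : ∀ p d → (p + d) * (p + d) + d * d ≡ p * p + ((p + d) + (p + d)) * d
      expand = solve-∀
      regroup : ∀ p y d e → p * p + (y + d * d + e) ≡ p * p + y + e + d * d
      regroup = solve-∀

  step : ∀ {n d Q A d′ Q′} → PQ D n ≡ state d Q →
         d ≤ M → 1 ≤ d′ → d′ ≤ M → d′ ≤ Q →
         A * Q + (d + d′) ≡ M + M → Norm d′ Q Q′ →
         PQ D (suc n) ≡ state d′ Q′ × cfSqrt D n ≡ A
  step {d = d} {Q} {A} {d′} {Q′} PQₙ d≤M 1≤d′ d′≤M d′≤Q sum norm =
    PQ-step isqrt≡M∸1 PQₙ (sum-of-deficits d≤M d′≤M sum)
      (completing-square {M ∸ d′} {d′} {Q * Q′} (subst (λ u → D + E ≡ u * u) M≡P′+d′ D+E≡M*M)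
                         (subst (λ u → Q * Q′ + d′ * d′ + E ≡ (u + u) * d′) M≡P′+d′ norm))
      (∸-monoʳ-≤ M 1≤d′) w<P′+Q
    where
    M≡P′+d′ : M ≡ M ∸ d′ + d′
    M≡P′+d′ = sym (m∸n+n≡m d′≤M)
    w<P′+Q : M ∸ 1 < M ∸ d′ + Q
    w<P′+Q = begin-strict
      M ∸ 1        <⟨ ∸-monoʳ-< (s≤s z≤n) (≤-trans 1≤d′ d′≤M) ⟩
      M            ≡⟨ M≡P′+d′ ⟩
      M ∸ d′ + d′  ≤⟨ +-monoʳ-≤ (M ∸ d′) d′≤Q ⟩
      M ∸ d′ + Q   ∎
      where open ≤-Reasoning

  PQ₀ : PQ D 0 ≡ state M 1
  PQ₀ = cong (_, 1) (sym (n∸n≡0 M))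

-- Periods

cfSqrt-cong : ∀ {D} m n → PQ D m ≡ PQ D n → cfSqrt D m ≡ cfSqrt D n
cfSqrt-cong {D} _ _ = cong (λ pq → divℕ (proj₁ pq + isqrt D) (proj₂ pq))

-- PQ D (suc n) reduces to next D (PQ D n).
next : ℕ → ℕ × ℕ → ℕ × ℕ
next D (P , Q) = let P′ = divℕ (P + isqrt D) Q * Q ∸ P in P′ , divℕ (D ∸ P′ * P′) Q

PQ-periodic : ∀ {D L} → PQ D (suc L) ≡ PQ D 1 → ∀ n → PQ D (suc n + L) ≡ PQ D (suc n)
PQ-periodic returns zero = returns
PQ-periodic {D} returns (suc n) = cong (next D) (PQ-periodic returns n)

isPeriod : ∀ {D L} → 0 < L → PQ D (suc L) ≡ PQ D 1 → IsPeriod D L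
isPeriod {D} {L} 0<L returns = 0<L , periodic
  where
  periodic : ∀ n → 1 ≤ n → cfSqrt D (n + L) ≡ cfSqrt D n
  periodic (suc n) _ = cfSqrt-cong (suc n + L) (suc n) (PQ-periodic returns n)

no-shorter-period : ∀ {D L} → (∀ n → 1 ≤ n → n < L → cfSqrt D n < cfSqrt D L) →
                    ∀ L′ → 0 < L′ → L′ < L → ¬ IsPeriod D L′
no-shorter-period {D} {L} below L′ 0<L′ L′<L (_ , periodic) =
  <-irrefl aₙ≡a_L (below n 1≤n (∸-monoʳ-< 0<L′ (<⇒≤ L′<L)))
  where
  n : ℕ
  n = L ∸ L′
  1≤n : 1 ≤ n
  1≤n = m<n⇒0<n∸m L′<L
  aₙ≡a_L : cfSqrt D n ≡ cfSqrt D L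
  aₙ≡a_L = trans (sym (periodic n 1≤n)) (cong (cfSqrt D) (m∸n+n≡m (<⇒≤ L′<L)))

cfSqrt-mod : ∀ {D L} .{{_ : NonZero L}} → IsPeriod D L → ∀ n → cfSqrt D (suc n) ≡ cfSqrt D (suc (n % L))
cfSqrt-mod {D} {L} (_ , periodic) n =
  trans (cong (λ i → cfSqrt D (suc i)) (m≡m%n+[m/n]*n n L)) (multiples (n / L) (n % L))
  where
  multiples : ∀ q i → cfSqrt D (suc i + q * L) ≡ cfSqrt D (suc i)
  multiples zero i = cong (cfSqrt D) (+-identityʳ (suc i))
  multiples (suc q) i = begin
    cfSqrt D (suc i + (L + q * L)) ≡⟨ cong (cfSqrt D) (shift i q) ⟩
    cfSqrt D (suc i + q * L + L)   ≡⟨ periodic (suc i + q * L) (s≤s z≤n) ⟩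
    cfSqrt D (suc i + q * L)       ≡⟨ multiples q i ⟩
    cfSqrt D (suc i)               ∎
    where
    open ≡-Reasoning
    shift : ∀ i q → suc i + (L + q * L) ≡ suc i + q * L + L
    shift i q = trans (cong (suc i +_) (+-comm L (q * L))) (sym (+-assoc (suc i) (q * L) L))

-- Segments of partial quotients

quotients : ℕ → ℕ → ℕ → List ℕ
quotients D n zero = []
quotients D n (suc ℓ) = cfSqrt D n ∷ quotients D (suc n) ℓ

quotients-3 : ∀ {D n x y z} → cfSqrt D n ≡ x → cfSqrt D (suc n) ≡ y → cfSqrt D (suc (suc n)) ≡ z →
              quotients D n 3 ≡ x ∷ y ∷ z ∷ []
quotients-3 aₙ≡x aₙ₊₁≡y aₙ₊₂≡z =
  cong₂ _∷_ aₙ≡x (cong₂ _∷_ aₙ₊₁≡y (cong (_∷ []) aₙ₊₂≡z))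

quotients-++ : ∀ D n p q → quotients D n (p + q) ≡ quotients D n p ++ quotients D (p + n) q
quotients-++ D n zero q = refl
quotients-++ D n (suc p) q = cong (cfSqrt D n ∷_)
  (trans (quotients-++ D (suc n) p q) (cong (λ i → quotients D (suc n) p ++ quotients D i q) (+-suc p n)))

length-quotients : ∀ D n ℓ → length (quotients D n ℓ) ≡ ℓ
length-quotients D n zero = refl
length-quotients D n (suc ℓ) = cong suc (length-quotients D (suc n) ℓ)

nth-quotients : ∀ D n {ℓ i} → i < ℓ → nth (quotients D n ℓ) i ≡ cfSqrt D (n + i)
nth-quotients D n {suc ℓ} {zero} _ = cong (cfSqrt D) (sym (+-identityʳ n))
nth-quotients D n {suc ℓ} {suc i} (s≤s i<ℓ) =
  trans (nth-quotients D (suc n) i<ℓ) (cong (cfSqrt D) (sym (+-suc n i)))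

concat-quotients : ∀ D {c} n ℓ (f : ℕ → List ℕ) →
                   (∀ {j} → j < ℓ → f j ≡ quotients D (j * c + n) c) →
                   concat (applyUpTo f ℓ) ≡ quotients D n (ℓ * c)
concat-quotients D n zero f blocks = refl
concat-quotients D {c} n (suc ℓ) f blocks = begin
  f 0 ++ concat (applyUpTo (f ∘ suc) ℓ)
    ≡⟨ cong₂ _++_ (blocks (s≤s z≤n)) (concat-quotients D (c + n) ℓ (f ∘ suc) shifted) ⟩
  quotients D n c ++ quotients D (c + n) (ℓ * c)
    ≡⟨ sym (quotients-++ D n c (ℓ * c)) ⟩
  quotients D n (c + ℓ * c) ∎
  where
  open ≡-Reasoning
  shifted : ∀ {j} → j < ℓ → f (suc j) ≡ quotients D (j * c + (c + n)) c
  shifted {j} j<ℓ = trans (blocks (s≤s j<ℓ))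
    (cong (λ i → quotients D i c) (trans (cong (_+ n) (+-comm c (j * c))) (+-assoc (j * c) c n)))

reverse-concat : ∀ {A : Set} (xss : List (List A)) → reverse (concat xss) ≡ concat (reverse (map reverse xss))
reverse-concat [] = refl
reverse-concat (xs ∷ xss) = begin
  reverse (xs ++ concat xss)
    ≡⟨ reverse-++ xs (concat xss) ⟩
  reverse (concat xss) ++ reverse xs
    ≡⟨ cong₂ _++_ (reverse-concat xss) (sym (++-identityʳ (reverse xs))) ⟩
  concat (reverse (map reverse xss)) ++ concat (reverse xs ∷ [])
    ≡⟨ concat-++ (reverse (map reverse xss)) (reverse xs ∷ []) ⟩
  concat (reverse (map reverse xss) ++ reverse xs ∷ [])
    ≡⟨ cong concat (sym (unfold-reverse (reverse xs) (map reverse xss))) ⟩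
  concat (reverse (map reverse (xs ∷ xss))) ∎
  where open ≡-Reasoning

applyDownFrom≡applyUpTo : ∀ {A : Set} (f : ℕ → A) n →
                          applyDownFrom f n ≡ applyUpTo (λ j → f (n ∸ suc j)) n
applyDownFrom≡applyUpTo f zero = refl
applyDownFrom≡applyUpTo f (suc n) = cong (f n ∷_) (applyDownFrom≡applyUpTo f n)

reverse-concatMap-upTo : ∀ {A : Set} (f : ℕ → List A) n →
                         reverse (concatMap f (upTo n)) ≡ concat (applyUpTo (λ j → reverse (f (n ∸ suc j))) n)
reverse-concatMap-upTo f n = begin
  reverse (concat (map f (upTo n)))
    ≡⟨ reverse-concat (map f (upTo n)) ⟩
  concat (reverse (map reverse (map f (upTo n))))
    ≡⟨ cong (λ xss → concat (reverse (map reverse xss))) (map-upTo f n) ⟩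
  concat (reverse (map reverse (applyUpTo f n)))
    ≡⟨ cong (λ xss → concat (reverse xss)) (map-applyUpTo f reverse n) ⟩
  concat (reverse (applyUpTo (reverse ∘ f) n))
    ≡⟨ cong concat (reverse-applyUpTo (reverse ∘ f) n) ⟩
  concat (applyDownFrom (reverse ∘ f) n)
    ≡⟨ cong concat (applyDownFrom≡applyUpTo (reverse ∘ f) n) ⟩
  concat (applyUpTo (λ j → reverse (f (n ∸ suc j))) n) ∎
  where open ≡-Reasoning

All-reverse : ∀ {A : Set} {P : A → Set} {xs} → All P xs → All P (reverse xs)
All-reverse Pxs = tabulate (λ x∈ → lookup Pxs (reverse⁻ x∈))

nth-++-All : ∀ {P : ℕ → Set} {xs} ys {i} → All P xs → i < length xs → P (nth (xs ++ ys) i)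
nth-++-All ys {zero} (px ∷ _) _ = px
nth-++-All ys {suc i} (_ ∷ pxs) (s≤s i<n) = nth-++-All ys pxs i<n

-- The expansion of √D for D = M² − 2mR

[m∸1]*n+n≡m*n : ∀ {m} n → 1 ≤ m → (m ∸ 1) * n + n ≡ m * n
[m∸1]*n+n≡m*n {suc m} n (s≤s z≤n) = +-comm (m * n) n

[m∸2]*n+[n+n]≡m*n : ∀ {m} n → 2 ≤ m → (m ∸ 2) * n + (n + n) ≡ m * n
[m∸2]*n+[n+n]≡m*n {suc (suc m)} n (s≤s (s≤s z≤n)) = expand m n
  where
  expand : ∀ m n → m * n + (n + n) ≡ suc (suc m) * n
  expand = solve-∀

m+n≤1+m*n : ∀ {m n} → 1 ≤ m → 1 ≤ n → m + n ≤ 1 + m * n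
m+n≤1+m*n {suc m} {suc n} _ _ =
  subst (suc m + suc n ≤_) (expand m n) (m≤m+n (suc m + suc n) (m * n))
  where
  expand : ∀ m n → suc m + suc n + m * n ≡ 1 + suc m * suc n
  expand = solve-∀

module Expansion (a m s r R : ℕ) (1<a : 1 < a) (1≤m : 1 ≤ m) (1≤s : 1 ≤ s) (1≤R : 1 ≤ R)
                 (r+1≡2ams : r + 1 ≡ 2 * a * m * s) where

  t M E D w : ℕ
  t = s + a * R
  M = m * t
  E = 2 * m * R
  D = m * (m * (t * t) ∸ 2 * R)
  w = M ∸ 1

  private instance
    a≢0 : NonZero a
    a≢0 = >-nonZero (<-trans (s≤s z≤n) 1<a)
    m≢0 : NonZero m
    m≢0 = >-nonZero 1≤m

  M+M≡2ms+2amR : M + M ≡ 2 * m * s + 2 * a * (m * R)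
  M+M≡2ms+2amR = expand m s a R
    where
    expand : ∀ m s a R → m * (s + a * R) + m * (s + a * R) ≡ 2 * m * s + 2 * a * (m * R)
    expand = solve-∀

  aR≤t : a * R ≤ t
  aR≤t = m≤n+m (a * R) s

  t≤M : t ≤ M
  t≤M = m≤n*m t m

  2≤t : 2 ≤ t
  2≤t = ≤-trans (≤-trans 1<a (m≤m*n a R {{>-nonZero 1≤R}})) aR≤t

  ≤R⇒≤M : ∀ {y} → y ≤ R → y ≤ M
  ≤R⇒≤M y≤R = ≤-trans y≤R (≤-trans (m≤n*m R a) (≤-trans aR≤t t≤M))

  ≤R⇒2m*≤M : ∀ {y} → y ≤ R → 2 * m * y ≤ M
  ≤R⇒2m*≤M {y} y≤R = begin
    2 * m * y     ≡⟨ regroup m y ⟩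
    m * (2 * y)   ≤⟨ *-monoʳ-≤ m (≤-trans (*-monoʳ-≤ 2 y≤R) (≤-trans (*-monoˡ-≤ R 1<a) aR≤t)) ⟩
    M             ∎
    where
    open ≤-Reasoning
    regroup : ∀ m y → 2 * m * y ≡ m * (2 * y)
    regroup = solve-∀

  1≤M : 1 ≤ M
  1≤M = ≤R⇒≤M 1≤R

  1≤2ms : 1 ≤ 2 * m * s
  1≤2ms = *-mono-≤ (*-mono-≤ (s≤s (z≤n {1})) 1≤m) 1≤s

  2≤2ms : 2 ≤ 2 * m * s
  2≤2ms = *-mono-≤ (*-mono-≤ (≤-refl {2}) 1≤m) 1≤s

  2ms≤r : 2 * m * s ≤ r
  2ms≤r = +-cancelʳ-≤ 1 (2 * m * s) r (begin
    2 * m * s + 1          ≤⟨ +-monoʳ-≤ (2 * m * s) 1≤2ms ⟩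
    2 * m * s + 2 * m * s  ≡⟨ regroup m s ⟩
    2 * 2 * (m * s)        ≤⟨ *-monoˡ-≤ (m * s) (*-monoʳ-≤ 2 1<a) ⟩
    2 * a * (m * s)        ≡⟨ regroup′ a m s ⟩
    2 * a * m * s          ≡⟨ sym r+1≡2ams ⟩
    r + 1                  ∎)
    where
    open ≤-Reasoning
    regroup : ∀ m s → 2 * m * s + 2 * m * s ≡ 2 * 2 * (m * s)
    regroup = solve-∀
    regroup′ : ∀ a m s → 2 * a * (m * s) ≡ 2 * a * m * s
    regroup′ = solve-∀

  s≤r : s ≤ r
  s≤r = ≤-trans (m≤n*m s (2 * m) {{>-nonZero (*-mono-≤ (s≤s (z≤n {1})) 1≤m)}}) 2ms≤r

  2≤r : 2 ≤ r
  2≤r = ≤-trans 2≤2ms 2ms≤r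

  1≤r : 1 ≤ r
  1≤r = ≤-trans (s≤s z≤n) 2≤r

  c+c′mR≤M+M : ∀ {c c′} → c ≤ 2 * m * s → c′ ≤ 2 * a → c + c′ * (m * R) ≤ M + M
  c+c′mR≤M+M c≤2ms c′≤2a =
    ≤-trans (+-mono-≤ c≤2ms (*-monoˡ-≤ (m * R) c′≤2a)) (≤-reflexive (sym M+M≡2ms+2amR))

  module _ (x z : ℕ) (xz≡R : x * z ≡ R) where

    factor-≤ˡ : 1 ≤ z → x ≤ R
    factor-≤ˡ 1≤z = subst (x ≤_) xz≡R (m≤m*n x z {{>-nonZero 1≤z}})

    factor-≤ʳ : 1 ≤ x → z ≤ R
    factor-≤ʳ 1≤x = subst (z ≤_) xz≡R (m≤n*m z x {{>-nonZero 1≤x}})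

    x*2mz≡E : x * (2 * m * z) ≡ E
    x*2mz≡E = trans (regroup x m z) (cong (2 * m *_) xz≡R)
      where
      regroup : ∀ x m z → x * (2 * m * z) ≡ 2 * m * (x * z)
      regroup = solve-∀

    2mz*x≡E : 2 * m * z * x ≡ E
    2mz*x≡E = trans (*-comm (2 * m * z) x) x*2mz≡E

    x+2mz+2mz≤M+M : 1 ≤ x → 1 ≤ z → x + 2 * m * z + 2 * m * z ≤ M + M
    x+2mz+2mz≤M+M 1≤x 1≤z = begin
      x + 2 * m * z + 2 * m * z  ≡⟨ regroup x m z ⟩
      x + 4 * (m * z)            ≤⟨ m+n≤1+m*n 1≤x (*-mono-≤ (s≤s (z≤n {3})) (*-mono-≤ 1≤m 1≤z)) ⟩
      1 + x * (4 * (m * z))      ≡⟨ cong (1 +_) (trans (regroup′ x m z) (cong (λ y → 4 * (m * y)) xz≡R)) ⟩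
      1 + 4 * (m * R)            ≤⟨ c+c′mR≤M+M 1≤2ms (*-monoʳ-≤ 2 1<a) ⟩
      M + M                      ∎
      where
      open ≤-Reasoning
      regroup : ∀ x m z → x + 2 * m * z + 2 * m * z ≡ x + 4 * (m * z)
      regroup = solve-∀
      regroup′ : ∀ x m z → x * (4 * (m * z)) ≡ 4 * (m * (x * z))
      regroup′ = solve-∀

    2mz+x+x≤M+M : 1 ≤ x → 1 ≤ z → 2 * m * z + x + x ≤ M + M
    2mz+x+x≤M+M 1≤x 1≤z = begin
      2 * m * z + x + x          ≡⟨ regroup x m z ⟩
      2 * (x + m * z)            ≤⟨ *-monoʳ-≤ 2 (m+n≤1+m*n 1≤x (*-mono-≤ 1≤m 1≤z)) ⟩
      2 * (1 + x * (m * z))      ≡⟨ trans (regroup′ x m z) (cong (λ y → 2 + 2 * (m * y)) xz≡R) ⟩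
      2 + 2 * (m * R)            ≤⟨ c+c′mR≤M+M 2≤2ms (*-monoʳ-≤ 2 (<⇒≤ 1<a)) ⟩
      M + M                      ∎
      where
      open ≤-Reasoning
      regroup : ∀ x m z → 2 * m * z + x + x ≡ 2 * (x + m * z)
      regroup = solve-∀
      regroup′ : ∀ x m z → 2 * (1 + x * (m * z)) ≡ 2 + 2 * (m * (x * z))
      regroup′ = solve-∀

  D+E≡M*M : D + E ≡ M * M
  D+E≡M*M = begin
    m * (m * (t * t) ∸ 2 * R) + 2 * m * R       ≡⟨ cong (m * (m * (t * t) ∸ 2 * R) +_) (regroup m R) ⟩
    m * (m * (t * t) ∸ 2 * R) + m * (2 * R)     ≡⟨ sym (*-distribˡ-+ m _ (2 * R)) ⟩
    m * (m * (t * t) ∸ 2 * R + 2 * R)           ≡⟨ cong (m *_) (m∸n+n≡m 2R≤mt²) ⟩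
    m * (m * (t * t))                           ≡⟨ regroup′ m t ⟩
    M * M                                       ∎
    where
    open ≡-Reasoning
    regroup : ∀ m R → 2 * m * R ≡ m * (2 * R)
    regroup = solve-∀
    regroup′ : ∀ m t → m * (m * (t * t)) ≡ m * t * (m * t)
    regroup′ = solve-∀
    2R≤mt² : 2 * R ≤ m * (t * t)
    2R≤mt² = ≤-trans (*-monoˡ-≤ R 1<a)
               (≤-trans aR≤t (≤-trans (m≤m*n t t {{>-nonZero (≤-trans (s≤s z≤n) 2≤t)}})
                                      (m≤n*m (t * t) m)))

  suc-w≡M : suc w ≡ M
  suc-w≡M = trans (+-comm 1 w) (m∸n+n≡m 1≤M)

  E≤w+w : E ≤ w + w
  E≤w+w = ≤-trans (≤-reflexive (regroup m R)) (+-mono-≤ mR≤w mR≤w)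
    where
    regroup : ∀ m R → 2 * m * R ≡ m * R + m * R
    regroup = solve-∀
    mR≤w : m * R ≤ w
    mR≤w = m+n≤o⇒m≤o∸n (m * R) (begin
      m * R + 1            ≤⟨ +-mono-≤ (*-monoʳ-≤ m (m≤n*m R a)) (*-mono-≤ 1≤m 1≤s) ⟩
      m * (a * R) + m * s  ≡⟨ +-comm (m * (a * R)) (m * s) ⟩
      m * s + m * (a * R)  ≡⟨ sym (*-distribˡ-+ m s (a * R)) ⟩
      M                    ∎)
      where open ≤-Reasoning

  w²<D<[1+w]² : w * w < D × D < suc w * suc w
  w²<D<[1+w]² = between-squares {D} {E} {w} (trans D+E≡M*M (cong (λ u → u * u) (sym suc-w≡M)))
                                (*-mono-≤ (*-mono-≤ (s≤s (z≤n {1})) 1≤m) 1≤R) E≤w+w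

  isqrt≡w : isqrt D ≡ w
  isqrt≡w = isqrt-unique {D} {w} (<⇒≤ (proj₁ w²<D<[1+w]²)) (proj₂ w²<D<[1+w]²)

  D-nonsquare : ∀ x → x * x ≢ D
  D-nonsquare = nonsquare {D} {w} (proj₁ w²<D<[1+w]²) (proj₂ w²<D<[1+w]²)

  open Deficits {D} {M} {E} D+E≡M*M isqrt≡w public

  -- The three shapes of complete quotients in the expansion. In K₁ c c̄ the deficits c and c̄ are
  -- x and 2mz (in either order) for a factorisation R = x z, so that c c̄ = E.
  K₁ : ℕ → ℕ → ℕ × ℕ
  K₁ c c̄ = state c (M + M ∸ (c + c̄))

  K₂ : ℕ → ℕ × ℕ
  K₂ c = state c c

  K₃ : ℕ → ℕ × ℕ
  K₃ Q = state (2 * m * s) Q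

  sum-2ms : ∀ {b c} → 1 ≤ b → b * c ≡ 2 * a * (m * R) → (b ∸ 1) * c + (c + 2 * m * s) ≡ M + M
  sum-2ms {b} {c} 1≤b bc≡2amR = begin
    (b ∸ 1) * c + (c + 2 * m * s)   ≡⟨ sym (+-assoc ((b ∸ 1) * c) c _) ⟩
    (b ∸ 1) * c + c + 2 * m * s     ≡⟨ cong (_+ 2 * m * s) (trans ([m∸1]*n+n≡m*n c 1≤b) bc≡2amR) ⟩
    2 * a * (m * R) + 2 * m * s     ≡⟨ +-comm (2 * a * (m * R)) (2 * m * s) ⟩
    2 * m * s + 2 * a * (m * R)     ≡⟨ sym M+M≡2ms+2amR ⟩
    M + M                           ∎
    where open ≡-Reasoning

  Norm-2ms : ∀ c c′ → c * c′ ≡ 2 * m * r * R → Norm (2 * m * s) c c′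
  Norm-2ms c c′ cc′≡2mrR = begin
    c * c′ + 2 * m * s * (2 * m * s) + 2 * m * R
      ≡⟨ cong (λ u → u + 2 * m * s * (2 * m * s) + 2 * m * R) cc′≡2mrR ⟩
    2 * m * r * R + 2 * m * s * (2 * m * s) + 2 * m * R
      ≡⟨ factor m r R s ⟩
    2 * m * R * (r + 1) + 2 * m * s * (2 * m * s)
      ≡⟨ cong (λ u → 2 * m * R * u + 2 * m * s * (2 * m * s)) r+1≡2ams ⟩
    2 * m * R * (2 * a * m * s) + 2 * m * s * (2 * m * s)
      ≡⟨ expand m R a s ⟩
    (m * (s + a * R) + m * (s + a * R)) * (2 * m * s) ∎
    where
    open ≡-Reasoning
    factor : ∀ m r R s → 2 * m * r * R + 2 * m * s * (2 * m * s) + 2 * m * R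
                         ≡ 2 * m * R * (r + 1) + 2 * m * s * (2 * m * s)
    factor = solve-∀
    expand : ∀ m R a s → 2 * m * R * (2 * a * m * s) + 2 * m * s * (2 * m * s)
                         ≡ (m * (s + a * R) + m * (s + a * R)) * (2 * m * s)
    expand = solve-∀

  K₁⇒K₂ : ∀ {n c c̄} → PQ D n ≡ K₁ c c̄ →
          c * c̄ ≡ E → c ≤ M → 1 ≤ c̄ → c̄ ≤ M → c + c̄ + c̄ ≤ M + M →
          PQ D (suc n) ≡ K₂ c̄ × cfSqrt D n ≡ 1
  K₁⇒K₂ {c = c} {c̄} PQₙ cc̄≡E c≤M 1≤c̄ c̄≤M c+c̄+c̄≤M+M =
    step PQₙ c≤M 1≤c̄ c̄≤M c̄≤Q (trans (cong (_+ (c + c̄)) (*-identityˡ Q)) Q+c+c̄≡M+M)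
         (Norm-comm c̄ Q (Norm-split c̄ c Q (trans (*-comm c̄ c) cc̄≡E)
                                       (trans (cong (Q +_) (+-comm c̄ c)) Q+c+c̄≡M+M)))
    where
    Q : ℕ
    Q = M + M ∸ (c + c̄)
    Q+c+c̄≡M+M : Q + (c + c̄) ≡ M + M
    Q+c+c̄≡M+M = m∸n+n≡m (m+n≤o⇒m≤o (c + c̄) c+c̄+c̄≤M+M)
    c̄≤Q : c̄ ≤ Q
    c̄≤Q = m+n≤o⇒m≤o∸n c̄ (subst (_≤ M + M) (+-comm (c + c̄) c̄) c+c̄+c̄≤M+M)

  K₂⇒K₃ : ∀ {n c b c′} → PQ D n ≡ K₂ c →
          1 ≤ b → b * c ≡ 2 * a * (m * R) → c * c′ ≡ 2 * m * r * R → c ≤ M → 2 * m * s ≤ c →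
          PQ D (suc n) ≡ K₃ c′ × cfSqrt D n ≡ b ∸ 1
  K₂⇒K₃ {c = c} {c′ = c′} PQₙ 1≤b bc≡2amR cc′≡2mrR c≤M 2ms≤c =
    step PQₙ c≤M 1≤2ms (≤-trans 2ms≤c c≤M) 2ms≤c (sum-2ms 1≤b bc≡2amR) (Norm-2ms c c′ cc′≡2mrR)

  K₃⇒K₁ : ∀ {n c c̄ b} → PQ D n ≡ K₃ c →
          1 ≤ b → b * c ≡ 2 * a * (m * R) → c * c̄ ≡ E → 2 * m * s ≤ M → 1 ≤ c → c ≤ M → c + c̄ ≤ M + M →
          PQ D (suc n) ≡ K₁ c c̄ × cfSqrt D n ≡ b ∸ 1
  K₃⇒K₁ {c = c} {c̄} {b} PQₙ 1≤b bc≡2amR cc̄≡E 2ms≤M 1≤c c≤M c+c̄≤M+M =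
    step PQₙ 2ms≤M 1≤c c≤M ≤-refl
         (trans (cong ((b ∸ 1) * c +_) (+-comm (2 * m * s) c)) (sum-2ms 1≤b bc≡2amR))
         (Norm-split c c̄ _ cc̄≡E (m∸n+n≡m c+c̄≤M+M))

  denominator-1⇒K₁ : ∀ {n d A} → PQ D n ≡ state d 1 → d ≤ M → A + (d + 1) ≡ M + M →
                     PQ D (suc n) ≡ K₁ 1 (2 * m * R) × cfSqrt D n ≡ A
  denominator-1⇒K₁ {d = d} {A} PQₙ d≤M sum =
    step PQₙ d≤M ≤-refl 1≤M ≤-refl (trans (cong (_+ (d + 1)) (*-identityʳ A)) sum)
         (Norm-split 1 (2 * m * R) _ (*-identityˡ E) (m∸n+n≡m 1+2mR≤M+M))
    where
    1+2mR≤M+M : 1 + 2 * m * R ≤ M + M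
    1+2mR≤M+M = m+n≤o⇒m≤o (1 + 2 * m * R) (x+2mz+2mz≤M+M 1 R (*-identityˡ R) ≤-refl 1≤R)

  start : PQ D 1 ≡ K₁ 1 (2 * m * R) × cfSqrt D 0 ≡ M ∸ 1
  start = denominator-1⇒K₁ {0} PQ₀ ≤-refl (halves 1≤M)
    where
    halves : ∀ {n} → 1 ≤ n → n ∸ 1 + (n + 1) ≡ n + n
    halves {suc n} _ = expand n
      where
      expand : ∀ n → n + (suc n + 1) ≡ suc n + suc n
      expand = solve-∀

  close : ∀ {n} → PQ D n ≡ K₂ 1 → PQ D (suc n) ≡ K₁ 1 (2 * m * R) × cfSqrt D n ≡ 2 * m * t ∸ 2
  close PQₙ = denominator-1⇒K₁ PQₙ 1≤M (trans (m∸n+n≡m 2≤2mt) (twice m t))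
    where
    2≤2mt : 2 ≤ 2 * m * t
    2≤2mt = *-mono-≤ (*-mono-≤ (≤-refl {2}) 1≤m) (≤-trans (s≤s z≤n) 2≤t)
    twice : ∀ m t → 2 * m * t ≡ m * t + m * t
    twice = solve-∀

  2m≤M : 2 * m * 1 ≤ M
  2m≤M = ≤R⇒2m*≤M 1≤R

  1≤2m : 1 ≤ 2 * m * 1
  1≤2m = *-mono-≤ (*-mono-≤ (s≤s (z≤n {1})) 1≤m) (≤-refl {1})

  K₂⇒K₁-middle : ∀ {n} → PQ D n ≡ K₂ (2 * m * 1) →
                 PQ D (suc n) ≡ K₁ (2 * m * 1) R × cfSqrt D n ≡ t ∸ 2
  K₂⇒K₁-middle PQₙ =
    step PQₙ 2m≤M 1≤2m 2m≤M ≤-refl (trans ([m∸2]*n+[n+n]≡m*n (2 * m * 1) 2≤t) (twice m t))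
         (Norm-split (2 * m * 1) R _ (2mz*x≡E R 1 (*-identityʳ R)) (m∸n+n≡m 2m+R≤M+M))
    where
    2m+R≤M+M : 2 * m * 1 + R ≤ M + M
    2m+R≤M+M = m+n≤o⇒m≤o (2 * m * 1 + R) (2mz+x+x≤M+M R 1 (*-identityʳ R) 1≤R ≤-refl)
    twice : ∀ m t → t * (2 * m * 1) ≡ m * t + m * t
    twice = solve-∀

  middle : ∀ {n} → PQ D n ≡ K₁ R (2 * m * 1) →
           quotients D n 3 ≡ 1 ∷ t ∸ 2 ∷ 1 ∷ [] × PQ D (3 + n) ≡ K₂ R
  middle {n} PQₙ = quotients-3 {D} {n} (proj₂ s₁) (proj₂ s₂) (proj₂ s₃) , proj₁ s₃
    where
    R*1≡R : R * 1 ≡ R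
    R*1≡R = *-identityʳ R
    R≤M : R ≤ M
    R≤M = ≤R⇒≤M ≤-refl
    s₁ : PQ D (suc n) ≡ K₂ (2 * m * 1) × cfSqrt D n ≡ 1
    s₁ = K₁⇒K₂ PQₙ (x*2mz≡E R 1 R*1≡R) R≤M 1≤2m 2m≤M (x+2mz+2mz≤M+M R 1 R*1≡R 1≤R ≤-refl)
    s₂ : PQ D (suc (suc n)) ≡ K₁ (2 * m * 1) R × cfSqrt D (suc n) ≡ t ∸ 2
    s₂ = K₂⇒K₁-middle {suc n} (proj₁ s₁)
    s₃ : PQ D (3 + n) ≡ K₂ R × cfSqrt D (suc (suc n)) ≡ 1
    s₃ = K₁⇒K₂ {suc (suc n)} (proj₁ s₂) (2mz*x≡E R 1 R*1≡R) 2m≤M 1≤R R≤M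
               (2mz+x+x≤M+M R 1 R*1≡R 1≤R ≤-refl)

  module Block {X Y : ℕ} (X*rY≡R : X * (r * Y) ≡ R) (1≤X : 1 ≤ X) (1≤Y : 1 ≤ Y) where

    private
      1≤rX : 1 ≤ r * X
      1≤rX = *-mono-≤ 1≤r 1≤X
      1≤rY : 1 ≤ r * Y
      1≤rY = *-mono-≤ 1≤r 1≤Y
      1≤2mrY : 1 ≤ 2 * m * (r * Y)
      1≤2mrY = *-mono-≤ (*-mono-≤ (s≤s (z≤n {1})) 1≤m) 1≤rY
      1≤aX : 1 ≤ a * X
      1≤aX = *-mono-≤ (<⇒≤ 1<a) 1≤X
      1≤2amY : 1 ≤ 2 * a * m * Y
      1≤2amY = *-mono-≤ (*-mono-≤ (*-mono-≤ (s≤s (z≤n {1})) (<⇒≤ 1<a)) 1≤m) 1≤Y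
      rX*Y≡R : r * X * Y ≡ R
      rX*Y≡R = trans (regroup r X Y) X*rY≡R
        where
        regroup : ∀ r X Y → r * X * Y ≡ X * (r * Y)
        regroup = solve-∀
      X≤M : X ≤ M
      X≤M = ≤R⇒≤M (factor-≤ˡ X (r * Y) X*rY≡R 1≤rY)
      rX≤M : r * X ≤ M
      rX≤M = ≤R⇒≤M (factor-≤ˡ (r * X) Y rX*Y≡R 1≤Y)
      2mrY≤M : 2 * m * (r * Y) ≤ M
      2mrY≤M = ≤R⇒2m*≤M (factor-≤ʳ X (r * Y) X*rY≡R 1≤X)
      2ms≤rX : 2 * m * s ≤ r * X
      2ms≤rX = ≤-trans 2ms≤r (m≤m*n r X {{>-nonZero 1≤X}})
      2ms≤2mrY : 2 * m * s ≤ 2 * m * (r * Y)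
      2ms≤2mrY = *-monoʳ-≤ (2 * m) (≤-trans s≤r (m≤m*n r Y {{>-nonZero 1≤Y}}))
      aX*2mrY≡2amR : a * X * (2 * m * (r * Y)) ≡ 2 * a * (m * R)
      aX*2mrY≡2amR = trans (regroup a X m r Y) (cong (λ u → 2 * a * (m * u)) X*rY≡R)
        where
        regroup : ∀ a X m r Y → a * X * (2 * m * (r * Y)) ≡ 2 * a * (m * (X * (r * Y)))
        regroup = solve-∀
      2amY*rX≡2amR : 2 * a * m * Y * (r * X) ≡ 2 * a * (m * R)
      2amY*rX≡2amR = trans (regroup a X m r Y) (cong (λ u → 2 * a * (m * u)) X*rY≡R)
        where
        regroup : ∀ a X m r Y → 2 * a * m * Y * (r * X) ≡ 2 * a * (m * (X * (r * Y)))
        regroup = solve-∀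
      2mrY*rX≡2mrR : 2 * m * (r * Y) * (r * X) ≡ 2 * m * r * R
      2mrY*rX≡2mrR = trans (regroup X m r Y) (cong (2 * m * r *_) X*rY≡R)
        where
        regroup : ∀ X m r Y → 2 * m * (r * Y) * (r * X) ≡ 2 * m * r * (X * (r * Y))
        regroup = solve-∀

    first : ∀ {n} → PQ D n ≡ K₁ X (2 * m * (r * Y)) →
            quotients D n 3 ≡ 1 ∷ a * X ∸ 1 ∷ 2 * a * m * Y ∸ 1 ∷ []
            × PQ D (3 + n) ≡ K₁ (r * X) (2 * m * Y)
    first {n} PQₙ = quotients-3 {D} {n} (proj₂ s₁) (proj₂ s₂) (proj₂ s₃) , proj₁ s₃
      where
      s₁ : PQ D (suc n) ≡ K₂ (2 * m * (r * Y)) × cfSqrt D n ≡ 1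
      s₁ = K₁⇒K₂ PQₙ (x*2mz≡E X (r * Y) X*rY≡R) X≤M 1≤2mrY 2mrY≤M
                 (x+2mz+2mz≤M+M X (r * Y) X*rY≡R 1≤X 1≤rY)
      s₂ : PQ D (suc (suc n)) ≡ K₃ (r * X) × cfSqrt D (suc n) ≡ a * X ∸ 1
      s₂ = K₂⇒K₃ {suc n} (proj₁ s₁) 1≤aX aX*2mrY≡2amR 2mrY*rX≡2mrR 2mrY≤M 2ms≤2mrY
      s₃ : PQ D (3 + n) ≡ K₁ (r * X) (2 * m * Y) × cfSqrt D (suc (suc n)) ≡ 2 * a * m * Y ∸ 1
      s₃ = K₃⇒K₁ {suc (suc n)} (proj₁ s₂) 1≤2amY 2amY*rX≡2amR (x*2mz≡E (r * X) Y rX*Y≡R)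
                 (≤-trans 2ms≤rX rX≤M) 1≤rX rX≤M
                 (m+n≤o⇒m≤o (r * X + 2 * m * Y) (x+2mz+2mz≤M+M (r * X) Y rX*Y≡R 1≤rX 1≤Y))

    second : ∀ {n} → PQ D n ≡ K₂ (r * X) →
             quotients D n 3 ≡ 2 * a * m * Y ∸ 1 ∷ a * X ∸ 1 ∷ 1 ∷ [] × PQ D (3 + n) ≡ K₂ X
    second {n} PQₙ = quotients-3 {D} {n} (proj₂ s₁) (proj₂ s₂) (proj₂ s₃) , proj₁ s₃
      where
      s₁ : PQ D (suc n) ≡ K₃ (2 * m * (r * Y)) × cfSqrt D n ≡ 2 * a * m * Y ∸ 1
      s₁ = K₂⇒K₃ PQₙ 1≤2amY 2amY*rX≡2amR (trans (*-comm (r * X) _) 2mrY*rX≡2mrR) rX≤M 2ms≤rX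
      s₂ : PQ D (suc (suc n)) ≡ K₁ (2 * m * (r * Y)) X × cfSqrt D (suc n) ≡ a * X ∸ 1
      s₂ = K₃⇒K₁ {suc n} (proj₁ s₁) 1≤aX aX*2mrY≡2amR (2mz*x≡E X (r * Y) X*rY≡R)
                 (≤-trans 2ms≤2mrY 2mrY≤M) 1≤2mrY 2mrY≤M
                 (m+n≤o⇒m≤o (2 * m * (r * Y) + X) (2mz+x+x≤M+M X (r * Y) X*rY≡R 1≤X 1≤rY))
      s₃ : PQ D (3 + n) ≡ K₂ X × cfSqrt D (suc (suc n)) ≡ 1
      s₃ = K₁⇒K₂ {suc (suc n)} (proj₁ s₂) (2mz*x≡E X (r * Y) X*rY≡R) 2mrY≤M 1≤X X≤M
                 (2mz+x+x≤M+M X (r * Y) X*rY≡R 1≤X 1≤rY)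

-- The family of the theorem: r = 2ams − 1 and R = r^k

module Family (a m s k : ℕ) (1<a : 1 < a) (1≤m : 1 ≤ m) (1≤s : 1 ≤ s) where

  r R : ℕ
  r = 2 * a * m * s ∸ 1
  R = r ^ k

  private
    2≤2ams : 2 ≤ 2 * a * m * s
    2≤2ams = *-mono-≤ (*-mono-≤ (*-mono-≤ (≤-refl {2}) (<⇒≤ 1<a)) 1≤m) 1≤s

    instance
      r≢0 : NonZero r
      r≢0 = >-nonZero (∸-monoˡ-≤ 1 2≤2ams)

  1≤r^ : ∀ e → 1 ≤ r ^ e
  1≤r^ e = m^n>0 r e

  open Expansion a m s r R 1<a 1≤m 1≤s (1≤r^ k) (m∸n+n≡m (≤-trans (s≤s z≤n) 2≤2ams)) public

  r^i*r^j≡R : ∀ i j → i + j ≡ k → r ^ i * r ^ j ≡ R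
  r^i*r^j≡R i j i+j≡k = trans (sym (^-distribˡ-+-* r i j)) (cong (r ^_) i+j≡k)

  r^[k∸j]≡r*r^[k∸1+j] : ∀ {j} → j < k → r ^ (k ∸ j) ≡ r * r ^ (k ∸ suc j)
  r^[k∸j]≡r*r^[k∸1+j] j<k = cong (r ^_) (+-∸-assoc 1 j<k)

  triple : ℕ → List ℕ
  triple j = 1 ∷ (a * r ^ j ∸ 1) ∷ (2 * a * m * r ^ (k ∸ 1 ∸ j) ∸ 1) ∷ []

  -- Layout of the period: triple j at index j * 3 + 1, the middle 1, t − 2, 1 at k * 3 + 1, the
  -- reversed triples from n₀ on, and the closing quotient 2M − 2 at k * 3 + n₀ = L.
  n₀ L : ℕ
  n₀ = 3 + (k * 3 + 1)
  L = 4 + 6 * k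

  L≡k*3+n₀ : L ≡ k * 3 + n₀
  L≡k*3+n₀ = expand k
    where
    expand : ∀ k → 4 + 6 * k ≡ k * 3 + (3 + (k * 3 + 1))
    expand = solve-∀

  first-half-block : ∀ {j} → j < k → PQ D (j * 3 + 1) ≡ K₁ (r ^ j) (2 * m * r ^ (k ∸ j)) →
                     quotients D (j * 3 + 1) 3 ≡ triple j
                     × PQ D (suc j * 3 + 1) ≡ K₁ (r ^ suc j) (2 * m * r ^ (k ∸ suc j))
  first-half-block {j} j<k PQₙ =
    trans (proj₁ block)
          (cong (λ e → 1 ∷ a * r ^ j ∸ 1 ∷ 2 * a * m * r ^ e ∸ 1 ∷ []) (sym (∸-+-assoc k 1 j))) ,
    proj₂ block
    where
    Y : ℕ
    Y = r ^ (k ∸ suc j)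
    block : quotients D (j * 3 + 1) 3 ≡ 1 ∷ a * r ^ j ∸ 1 ∷ 2 * a * m * Y ∸ 1 ∷ []
            × PQ D (3 + (j * 3 + 1)) ≡ K₁ (r * r ^ j) (2 * m * Y)
    block = Block.first (r^i*r^j≡R j (suc (k ∸ suc j)) (trans (+-suc j (k ∸ suc j)) (m+[n∸m]≡n j<k)))
                        (1≤r^ j) (1≤r^ (k ∸ suc j))
                        (subst (λ u → PQ D (j * 3 + 1) ≡ K₁ (r ^ j) (2 * m * u))
                               (r^[k∸j]≡r*r^[k∸1+j] j<k) PQₙ)

  first-half-state : ∀ j → j ≤ k → PQ D (j * 3 + 1) ≡ K₁ (r ^ j) (2 * m * r ^ (k ∸ j))
  first-half-state zero _ = proj₁ start
  first-half-state (suc j) j<k = proj₂ (first-half-block j<k (first-half-state j (<⇒≤ j<k)))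

  middle-block : quotients D (k * 3 + 1) 3 ≡ 1 ∷ t ∸ 2 ∷ 1 ∷ [] × PQ D n₀ ≡ K₂ R
  middle-block = middle {k * 3 + 1} (subst (λ e → PQ D (k * 3 + 1) ≡ K₁ R (2 * m * r ^ e)) (n∸n≡0 k)
                                           (first-half-state k ≤-refl))

  second-half-block : ∀ {j} → j < k → PQ D (j * 3 + n₀) ≡ K₂ (r ^ (k ∸ j)) →
                      quotients D (j * 3 + n₀) 3 ≡ reverse (triple (k ∸ suc j))
                      × PQ D (suc j * 3 + n₀) ≡ K₂ (r ^ (k ∸ suc j))
  second-half-block {j} j<k PQₙ =
    trans (proj₁ block)
          (cong (λ e → 2 * a * m * r ^ e ∸ 1 ∷ a * X ∸ 1 ∷ 1 ∷ []) (sym k∸1∸[k∸1+j]≡j)) ,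
    proj₂ block
    where
    X : ℕ
    X = r ^ (k ∸ suc j)
    block : quotients D (j * 3 + n₀) 3 ≡ 2 * a * m * r ^ j ∸ 1 ∷ a * X ∸ 1 ∷ 1 ∷ []
            × PQ D (3 + (j * 3 + n₀)) ≡ K₂ X
    block = Block.second (r^i*r^j≡R (k ∸ suc j) (suc j) (m∸n+n≡m j<k)) (1≤r^ (k ∸ suc j)) (1≤r^ j)
                         (subst (λ u → PQ D (j * 3 + n₀) ≡ K₂ u) (r^[k∸j]≡r*r^[k∸1+j] j<k) PQₙ)
    k∸1∸[k∸1+j]≡j : k ∸ 1 ∸ (k ∸ suc j) ≡ j
    k∸1∸[k∸1+j]≡j = trans (cong (k ∸ 1 ∸_) (sym (∸-+-assoc k 1 j)))
                          (m∸[m∸n]≡n (m+n≤o⇒m≤o∸n j (subst (_≤ k) (+-comm 1 j) j<k)))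

  second-half-state : ∀ j → j ≤ k → PQ D (j * 3 + n₀) ≡ K₂ (r ^ (k ∸ j))
  second-half-state zero _ = proj₂ middle-block
  second-half-state (suc j) j<k = proj₂ (second-half-block j<k (second-half-state j (<⇒≤ j<k)))

  closing-step : PQ D (suc (k * 3 + n₀)) ≡ K₁ 1 (2 * m * R) × cfSqrt D (k * 3 + n₀) ≡ 2 * m * t ∸ 2
  closing-step = close {k * 3 + n₀} (subst (λ e → PQ D (k * 3 + n₀) ≡ K₂ (r ^ e)) (n∸n≡0 k)
                                           (second-half-state k ≤-refl))

  PQ-period : PQ D (suc L) ≡ PQ D 1
  PQ-period = trans (cong (λ i → PQ D (suc i)) L≡k*3+n₀) (trans (proj₁ closing-step) (sym (proj₁ start)))

  cfSqrt-L : cfSqrt D L ≡ 2 * m * t ∸ 2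
  cfSqrt-L = trans (cong (cfSqrt D) L≡k*3+n₀) (proj₂ closing-step)

  bSeq≡quotients : bSeq a m r k ≡ quotients D 1 (k * 3)
  bSeq≡quotients =
    trans (cong concat (map-upTo triple k))
          (concat-quotients D 1 k triple
            (λ j<k → sym (proj₁ (first-half-block j<k (first-half-state _ (<⇒≤ j<k))))))

  reverse-bSeq≡quotients : reverse (bSeq a m r k) ≡ quotients D n₀ (k * 3)
  reverse-bSeq≡quotients =
    trans (reverse-concatMap-upTo triple k)
          (concat-quotients D n₀ k (λ j → reverse (triple (k ∸ suc j)))
            (λ j<k → sym (proj₁ (second-half-block j<k (second-half-state _ (<⇒≤ j<k))))))

  periodBlock≡quotients : periodBlock a m s k ≡ quotients D 1 L
  periodBlock≡quotients = begin
    periodBlock a m s k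
      ≡⟨ cong₂ _++_ bSeq≡quotients
           (cong₂ _++_ (sym (proj₁ middle-block))
             (cong₂ _++_ reverse-bSeq≡quotients (cong (_∷ []) (sym (proj₂ closing-step))))) ⟩
    quotients D 1 (k * 3) ++ (quotients D (k * 3 + 1) 3 ++ (quotients D n₀ (k * 3) ++ quotients D (k * 3 + n₀) 1))
      ≡⟨ sym (trans (quotients-++ D 1 (k * 3) _) (cong (quotients D 1 (k * 3) ++_)
               (trans (quotients-++ D (k * 3 + 1) 3 _) (cong (quotients D (k * 3 + 1) 3 ++_)
                 (quotients-++ D n₀ (k * 3) 1))))) ⟩
    quotients D 1 (k * 3 + n₀)
      ≡⟨ cong (quotients D 1) (sym L≡k*3+n₀) ⟩
    quotients D 1 L ∎
    where open ≡-Reasoning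

  cfSqrt≡periodBlock : ∀ {i} → i < L → cfSqrt D (suc i) ≡ nth (periodBlock a m s k) i
  cfSqrt≡periodBlock {i} i<L =
    sym (trans (cong (λ xs → nth xs i) periodBlock≡quotients) (nth-quotients D 1 i<L))

  1≤w : 1 ≤ w
  1≤w = ∸-monoˡ-≤ 1 (≤-trans 2≤t t≤M)

  2mt∸2≡w+w : 2 * m * t ∸ 2 ≡ w + w
  2mt∸2≡w+w = trans (cong (_∸ 2) (trans (twice m t) (cong₂ _+_ (sym suc-w≡M) (sym suc-w≡M))))
                    (cong (_∸ 1) (+-suc w w))
    where
    twice : ∀ m t → 2 * m * t ≡ m * t + m * t
    twice = solve-∀

  triple-≤ : ∀ {j} → j < k → All (_≤ w) (triple j)
  triple-≤ {j} j<k = 1≤w ∷ ∸-monoˡ-≤ 1 arʲ≤M ∷ ∸-monoˡ-≤ 1 2amrᵉ≤M ∷ []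
    where
    arʲ≤M : a * r ^ j ≤ M
    arʲ≤M = ≤-trans (*-monoʳ-≤ a (^-monoʳ-≤ r (<⇒≤ j<k))) (≤-trans aR≤t t≤M)
    e : ℕ
    e = k ∸ 1 ∸ j
    1+e≤k : suc e ≤ k
    1+e≤k = ≤-trans (s≤s (m∸n≤m (k ∸ 1) j))
                    (≤-reflexive (trans (+-comm 1 (k ∸ 1)) (m∸n+n≡m (≤-trans (s≤s z≤n) j<k))))
    2amrᵉ≤M : 2 * a * m * r ^ e ≤ M
    2amrᵉ≤M = begin
      2 * a * m * r ^ e      ≡⟨ regroup a m (r ^ e) ⟩
      m * (a * (2 * r ^ e))  ≤⟨ *-monoʳ-≤ m (*-monoʳ-≤ a 2rᵉ≤R) ⟩
      m * (a * R)            ≤⟨ *-monoʳ-≤ m aR≤t ⟩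
      M                      ∎
      where
      open ≤-Reasoning
      regroup : ∀ a m y → 2 * a * m * y ≡ m * (a * (2 * y))
      regroup = solve-∀
      2rᵉ≤R : 2 * r ^ e ≤ R
      2rᵉ≤R = ≤-trans (*-monoˡ-≤ (r ^ e) 2≤r) (^-monoʳ-≤ r 1+e≤k)

  bSeq-≤ : All (_≤ w) (bSeq a m r k)
  bSeq-≤ = concat⁺ (map⁺ (applyUpTo⁺₁ id k triple-≤))

  periodBlock-init : List ℕ
  periodBlock-init = bSeq a m r k ++ (1 ∷ t ∸ 2 ∷ 1 ∷ reverse (bSeq a m r k))

  periodBlock-init-≤ : All (_≤ w) periodBlock-init
  periodBlock-init-≤ =
    ++⁺ bSeq-≤ (1≤w ∷ t∸2≤w ∷ 1≤w ∷ All-reverse bSeq-≤)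
    where
    t∸2≤w : t ∸ 2 ≤ w
    t∸2≤w = ≤-trans (∸-monoʳ-≤ t (s≤s (z≤n {1}))) (∸-monoˡ-≤ 1 t≤M)

  length-periodBlock-init : length periodBlock-init ≡ k * 3 + (3 + k * 3)
  length-periodBlock-init =
    trans (length-++ (bSeq a m r k))
          (cong₂ (λ u v → u + (3 + v)) length-bSeq (trans (length-reverse (bSeq a m r k)) length-bSeq))
    where
    length-bSeq : length (bSeq a m r k) ≡ k * 3
    length-bSeq = trans (cong length bSeq≡quotients) (length-quotients D 1 (k * 3))

  cfSqrt<cfSqrt-L : ∀ n → 1 ≤ n → n < L → cfSqrt D n < cfSqrt D L
  cfSqrt<cfSqrt-L (suc i) _ 1+i<L = begin-strict
    cfSqrt D (suc i)
      ≡⟨ cfSqrt≡periodBlock (<-trans (n<1+n i) 1+i<L) ⟩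
    nth (periodBlock a m s k) i
      ≡⟨ cong (λ xs → nth xs i) (sym (++-assoc (bSeq a m r k) _ _)) ⟩
    nth (periodBlock-init ++ (2 * m * t ∸ 2) ∷ []) i
      ≤⟨ nth-++-All _ periodBlock-init-≤ i<length ⟩
    w
      <⟨ m<m+n w 1≤w ⟩
    w + w
      ≡⟨ sym 2mt∸2≡w+w ⟩
    2 * m * t ∸ 2
      ≡⟨ sym cfSqrt-L ⟩
    cfSqrt D L ∎
    where
    open ≤-Reasoning
    expand : ∀ k → 3 + 6 * k ≡ k * 3 + (3 + k * 3)
    expand = solve-∀
    i<length : i < length periodBlock-init
    i<length = subst (i <_) (trans (expand k) (sym length-periodBlock-init)) (≤-pred 1+i<L)

theorem4 : (a m s k : ℕ) → 1 < a → 1 ≤ m → 1 ≤ s → 1 ≤ k →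
    let r = 2 * a * m * s ∸ 1
        t = s + a * r ^ k
        D = m * (m * (t * t) ∸ 2 * r ^ k)
    in (∀ x → x * x ≢ D)
       × PeriodLength D (4 + 6 * k)
       × cfSqrt D 0 ≡ m * t ∸ 1
       × (∀ n → cfSqrt D (suc n) ≡ nth (periodBlock a m s k) (n % (4 + 6 * k)))
theorem4 a m s k 1<a 1≤m 1≤s _ =
  D-nonsquare , (period , no-shorter-period cfSqrt<cfSqrt-L) , proj₂ start , quotient
  where
  open Family a m s k 1<a 1≤m 1≤s
  period : IsPeriod D L
  period = isPeriod (s≤s z≤n) PQ-period
  quotient : ∀ n → cfSqrt D (suc n) ≡ nth (periodBlock a m s k) (n % L)
  quotient n = trans (cfSqrt-mod period n) (cfSqrt≡periodBlock (m%n<n n L))
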